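{- Let $M=(X,P,v)$ be an expertise model and let $R_P$ be the relation on $X$ defined by $x R_P y$ iff $A_x = A_y$, where $A_x=\bigcap\{A\in P\mid x\in A\}$. Then $M^*=(X,R_P,v)$ is an S5 model (i.e. $R_P$ is an equivalence relation), and for every $x\in X$ and every $\phi\in\mathcal{L}$, $$M,x\vDash\phi \iff M^*,x\vDash t(\phi).$$
   Context: Let $\mathsf{Prop}$ be a countable set of propositional variables. The language $\mathcal{L}$ is given by $\phi ::= p \mid \neg\phi \mid \phi\wedge\phi \mid \mathsf{E}\phi \mid \mathsf{S}\phi \mid \mathsf{A}\phi$. An expertise frame is $(X,P)$ with $P\subseteq 2^X$ satisfying (P1) $X\in P$, (P2) closure under complement in $X$, (P3) closure under arbitrary intersections; an expertise model $M=(X,P,v)$ adds a valuation $v:\mathsf{Prop}\to 2^X$. Satisfaction in expertise models: atoms and Boolean connectives standard; $M,x\vDash\mathsf{E}\phi$ iff $\|\phi\|_M\in P$; $M,x\vDash\mathsf{S}\phi$ iff for all $A\in P$, $\|\phi\|_M\subseteq A$ implies $x\in A$; $M,x\vDash\mathsf{A}\phi$ iff $M,y\vDash\phi$ for all $y\in X$; $\|\phi\|_M=\{x\mid M,x\vDash\phi\}$. The language $\mathcal{L}_{\mathsf{K}\mathsf{A}}$ is $\phi ::= p\mid\neg\phi\mid\phi\wedge\phi\mid\mathsf{K}\phi\mid\mathsf{A}\phi$. A relational model is $(X,R,v)$ with $R\subseteq X\times X$; it is an S5 model if $R$ is an equivalence relation. Relational satisfaction: Boolean clauses standard; $x\vDash\mathsf{K}\phi$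 iff $y\vDash\phi$ for all $y$ with $xRy$; $x\vDash\mathsf{A}\phi$ iff $y\vDash\phi$ for all $y\in X$. The translation $t:\mathcal{L}\to\mathcal{L}_{\mathsf{K}\mathsf{A}}$ is defined by $t(p)=p$, $t(\neg\phi)=\neg t(\phi)$, $t(\phi\wedge\psi)=t(\phi)\wedge t(\psi)$, $t(\mathsf{A}\phi)=\mathsf{A}t(\phi)$, $t(\mathsf{E}\phi)=\mathsf{A}(t(\phi)\rightarrow\mathsf{K}t(\phi))$, $t(\mathsf{S}\phi)=\neg\mathsf{K}\neg t(\phi)$. -}

module Defs where

open import Level using (Level; suc; _⊔_; Lift)
open import Data.Nat using (ℕ)
open import Data.Bool using (Bool; true; false; not)
open import Data.Product using (Σ; _×_; _,_)
open import Data.Empty using (⊥)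
open import Relation.Nullary using (¬_)
open import Relation.Binary.PropositionalEquality using (_≡_)
open import Function.Bundles using (_⇔_)

Var : Set
Var = ℕ

data Form : Set where
  var : Var → Form
  ¬ᶠ_ : Form → Form
  _∧ᶠ_ : Form → Form → Form
  E : Form → Form
  S : Form → Form
  A : Form → Form

data FormKA : Set where
  var : Var → FormKA
  ¬ᵏ_ : FormKA → FormKA
  _∧ᵏ_ : FormKA → FormKA → FormKA
  K : FormKA → FormKA
  Aᵏ : FormKA → FormKA

_⇒ᵏ_ : FormKA → FormKA → FormKA
φ ⇒ᵏ ψ = ¬ᵏ (φ ∧ᵏ (¬ᵏ ψ))

t : Form → FormKA
t (var p) = var p
t (¬ᶠ φ) = ¬ᵏ t φ
t (φ ∧ᶠ ψ) = t φ ∧ᵏ t ψ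
t (A φ) = Aᵏ (t φ)
t (E φ) = Aᵏ (t φ ⇒ᵏ K (t φ))
t (S φ) = ¬ᵏ (K (¬ᵏ (t φ)))

Subset : ∀ {a} → Set a → Set a
Subset X = X → Bool

_∈_ : ∀ {a} {X : Set a} → X → Subset X → Set a
_∈_ {a} x B = Lift a (B x ≡ true)

record ExpertiseFrame (a : Level) : Set (suc a) where
  field
    X  : Set a
    P  : Subset X → Set a
    P1 : P (λ _ → true)
    P2 : ∀ B → P B → P (λ x → not (B x))
    -- (P3) closure under arbitrary intersections: for every subfamily
    -- Q ⊆ P, the intersection ⋂Q (any set whose members are exactly the
    -- points belonging to all members of Q) is in P.
    P3 : (Q : Subset X → Set a) → (∀ B → Q B → P B) →
         (I : Subset X) →
         (∀ y → y ∈ I ⇔ (∀ B → Q B → y ∈ B)) → P I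

record ExpertiseModel (a : Level) : Set (suc a) where
  field
    frame : ExpertiseFrame a
  open ExpertiseFrame frame public
  field
    v : Var → Subset X

module _ {a : Level} (M : ExpertiseModel a) where
  open ExpertiseModel M

  infix 4 _⊨_
  _⊨_ : X → Form → Set a
  x ⊨ var p = x ∈ v p
  x ⊨ (¬ᶠ φ) = ¬ (x ⊨ φ)
  x ⊨ (φ ∧ᶠ ψ) = (x ⊨ φ) × (x ⊨ ψ)
  -- ‖φ‖ ∈ P : some member of P has exactly the extension ‖φ‖
  x ⊨ E φ = Σ (Subset X) λ B → P B × (∀ y → y ∈ B ⇔ y ⊨ φ)
  x ⊨ S φ = ∀ B → P B → (∀ y → y ⊨ φ → y ∈ B) → x ∈ B
  x ⊨ A φ = ∀ y → y ⊨ φ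

  _∈A[_] : X → X → Set a
  z ∈A[ x ] = ∀ B → P B → x ∈ B → z ∈ B

  R-P : X → X → Set a
  R-P x y = ∀ z → (z ∈A[ x ]) ⇔ (z ∈A[ y ])

record RelModel (a : Level) : Set (suc a) where
  field
    X : Set a
    R : X → X → Set a
    v : Var → Subset X

module _ {a : Level} (N : RelModel a) where
  open RelModel N

  infix 4 _⊨ᵏ_
  _⊨ᵏ_ : X → FormKA → Set a
  x ⊨ᵏ var p = x ∈ v p
  x ⊨ᵏ (¬ᵏ φ) = ¬ (x ⊨ᵏ φ)
  x ⊨ᵏ (φ ∧ᵏ ψ) = (x ⊨ᵏ φ) × (x ⊨ᵏ ψ)
  x ⊨ᵏ K φ = ∀ y → R x y → y ⊨ᵏ φ
  x ⊨ᵏ Aᵏ φ = ∀ y → y ⊨ᵏ φ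

star : ∀ {a} → ExpertiseModel a → RelModel a
star M = record { X = ExpertiseModel.X M ; R = R-P M ; v = ExpertiseModel.v M }

-- By (P3), A_x is the least member of P containing x, and (P2) makes these
-- the blocks of a partition: if w ∈ A_x but x ∉ A_w, the complement of A_w
-- is a member of P containing x but not w. Hence x R_P w iff w ∈ A_x, and
-- the members of P are exactly the R_P-closed sets. This turns E φ into
-- "‖φ‖ is closed under R_P", i.e. A(φ → K φ), and S φ, membership in the
-- least member of P containing ‖φ‖, into "some R_P-neighbour satisfies φ",
-- i.e. ¬ K ¬ φ.
module Submission where

open import Defs
open import Level using (Level; lift)
open import Data.Bool using (true; false; not)
open import Data.Product using (_×_; _,_; proj₁; proj₂; Σ-syntax)
open import Data.Empty using (⊥-elim)
open import Function.Bundles using (_⇔_; mk⇔; Equivalence)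
open import Function.Properties.Equivalence using (⇔-setoid)
open import Relation.Binary.Structures using (IsEquivalence)
open import Relation.Binary.PropositionalEquality using (_≡_; refl)
open import Relation.Nullary using (yes; no; does; ¬_)
open import Axiom.ExcludedMiddle using (ExcludedMiddle)
open import Axiom.DoubleNegationElimination using (em⇒dne)

open Equivalence using (to; from)

∈-complement : ∀ {a} {X : Set a} (B : Subset X) {x : X} →
               x ∈ (λ y → not (B y)) ⇔ (¬ x ∈ B)
∈-complement B {x} with B x
... | true  = mk⇔ (λ { (lift ()) }) (λ x∉B → ⊥-elim (x∉B (lift refl)))
... | false = mk⇔ (λ _ ()) (λ _ → lift refl)

module Comprehension {a : Level} (em : ExcludedMiddle a) {X : Set a} where

  ⟦_⟧ : (X → Set a) → Subset X
  ⟦ Q ⟧ x = does (em {Q x})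

  ∈⟦⟧ : ∀ (Q : X → Set a) {x : X} → x ∈ ⟦ Q ⟧ ⇔ Q x
  ∈⟦⟧ Q {x} with em {Q x}
  ... | yes q = mk⇔ (λ _ → q) (λ _ → lift refl)
  ... | no ¬q = mk⇔ (λ { (lift ()) }) (λ q → ⊥-elim (¬q q))

module ExpertiseModelProperties {a : Level} (em : ExcludedMiddle a)
                                (M : ExpertiseModel a) where
  open ExpertiseModel M
  open Comprehension em

  infix 4 _~_ _∈A_
  _~_ : X → X → Set a
  _~_ = R-P M

  _∈A_ : X → X → Set a
  z ∈A x = _∈A[_] M z x

  InP : (X → Set a) → Set a
  InP Q = Σ[ B ∈ Subset X ] P B × (∀ y → y ∈ B ⇔ Q y)

  InPClosure : (X → Set a) → X → Set a
  InPClosure Q x = ∀ B → P B → (∀ y → Q y → y ∈ B) → x ∈ B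

  Closed : (X → Set a) → Set a
  Closed Q = ∀ y → Q y → ∀ z → y ~ z → Q z

  dne : ∀ {Q : Set a} → ¬ ¬ Q → Q
  dne = em⇒dne em

  ⋂ᴾ : (Subset X → Set a) → X → Set a
  ⋂ᴾ Q y = ∀ B → P B → Q B → y ∈ B

  ⋂ᴾ-inP : (Q : Subset X → Set a) → InP (⋂ᴾ Q)
  ⋂ᴾ-inP Q = ⟦ ⋂ᴾ Q ⟧ , P3 (λ B → P B × Q B) (λ _ → proj₁) ⟦ ⋂ᴾ Q ⟧ ∈⋂ ,
                   λ _ → ∈⟦⟧ (⋂ᴾ Q)
    where
    ∈⋂ : ∀ y → y ∈ ⟦ ⋂ᴾ Q ⟧ ⇔ (∀ B → P B × Q B → y ∈ B)
    ∈⋂ y = mk⇔ (λ y∈ B (PB , QB) → to (∈⟦⟧ (⋂ᴾ Q)) y∈ B PB QB)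
               (λ y∈ → from (∈⟦⟧ (⋂ᴾ Q)) λ B PB QB → y∈ B (PB , QB))

  ∈A-refl : ∀ x → x ∈A x
  ∈A-refl x _ _ x∈B = x∈B

  ∈A-trans : ∀ {x y z} → y ∈A x → z ∈A y → z ∈A x
  ∈A-trans y∈Ax z∈Ay B PB x∈B = z∈Ay B PB (y∈Ax B PB x∈B)

  cell-inP : ∀ x → InP (_∈A x)
  cell-inP x = ⋂ᴾ-inP (x ∈_)

  separate-from-cell : ∀ x (Q : X → Set a) → (∀ w → Q w → ¬ w ∈A x) →
                       Σ[ B ∈ Subset X ] P B × (∀ w → Q w → w ∈ B) × ¬ x ∈ B
  separate-from-cell x Q Q∩Ax=∅ =
    (λ y → not (Ax y)) , P2 Ax PAx , Q⊆∁Ax , λ x∈∁Ax → to (∈-complement Ax) x∈∁Ax x∈Ax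
    where
    Ax = proj₁ (cell-inP x)
    PAx = proj₁ (proj₂ (cell-inP x))
    Ax≡ = proj₂ (proj₂ (cell-inP x))
    x∈Ax = from (Ax≡ x) (∈A-refl x)
    Q⊆∁Ax : ∀ w → Q w → w ∈ (λ y → not (Ax y))
    Q⊆∁Ax w Qw = from (∈-complement Ax) λ w∈Ax → Q∩Ax=∅ w Qw (to (Ax≡ w) w∈Ax)

  ∈A-sym : ∀ {x w} → w ∈A x → x ∈A w
  ∈A-sym {x} {w} w∈Ax = dne λ x∉Aw →
    let B , PB , x∈B , w∉B = separate-from-cell w (_≡ x)
                               (λ { _ refl → x∉Aw })
    in w∉B (w∈Ax B PB (x∈B x refl))

  ~⇔∈A : ∀ {x w} → x ~ w ⇔ w ∈A x
  ~⇔∈A {x} {w} = mk⇔ (λ x~w → from (x~w w) (∈A-refl w))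
                      (λ w∈Ax z → mk⇔ (∈A-trans (∈A-sym w∈Ax)) (∈A-trans w∈Ax))

  ~-isEquivalence : IsEquivalence _~_
  ~-isEquivalence = record
    { refl  = λ _ → mk⇔ (λ z∈ → z∈) (λ z∈ → z∈)
    ; sym   = λ x~y z → mk⇔ (from (x~y z)) (to (x~y z))
    ; trans = λ x~y y~w z → mk⇔ (λ z∈ → to (y~w z) (to (x~y z) z∈))
                                (λ z∈ → from (x~y z) (from (y~w z) z∈))
    }

  open IsEquivalence ~-isEquivalence using () renaming (refl to ~-refl; sym to ~-sym)

  inPClosure⇔◇ : ∀ {Q : X → Set a} {x} →
                 InPClosure Q x ⇔ (¬ (∀ y → x ~ y → ¬ Q y))
  inPClosure⇔◇ {Q} {x} = mk⇔ inPClosure⇒◇ ◇⇒inPClosure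
    where
    inPClosure⇒◇ : InPClosure Q x → ¬ (∀ y → x ~ y → ¬ Q y)
    inPClosure⇒◇ x∈cl □¬Q =
      let B , PB , Q⊆B , x∉B = separate-from-cell x Q λ w Qw w∈Ax →
            □¬Q w (from ~⇔∈A w∈Ax) Qw
      in x∉B (x∈cl B PB Q⊆B)
    ◇⇒inPClosure : ¬ (∀ y → x ~ y → ¬ Q y) → InPClosure Q x
    ◇⇒inPClosure ◇Q B PB Q⊆B = dne λ x∉B →
      ◇Q λ y x~y Qy → x∉B (to ~⇔∈A (~-sym x~y) B PB (Q⊆B y Qy))

  ◇-cong : ∀ {Q Q′ : X → Set a} {x} → (∀ y → Q y ⇔ Q′ y) →
           (¬ (∀ y → x ~ y → ¬ Q y)) ⇔ (¬ (∀ y → x ~ y → ¬ Q′ y))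
  ◇-cong Q≡Q′ = mk⇔ (λ ◇Q □¬Q′ → ◇Q λ y x~y Qy → □¬Q′ y x~y (to (Q≡Q′ y) Qy))
                    (λ ◇Q′ □¬Q → ◇Q′ λ y x~y Q′y → □¬Q y x~y (from (Q≡Q′ y) Q′y))

  inP-cong : ∀ {Q Q′ : X → Set a} → (∀ y → Q y ⇔ Q′ y) → InP Q → InP Q′
  inP-cong Q≡Q′ (B , PB , B≡Q) = B , PB , λ y →
    mk⇔ (λ y∈B → to (Q≡Q′ y) (to (B≡Q y) y∈B))
        (λ Q′y → from (B≡Q y) (from (Q≡Q′ y) Q′y))

  inP⇔closed : ∀ {Q : X → Set a} → InP Q ⇔ Closed Q
  inP⇔closed {Q} = mk⇔ inP⇒closed closed⇒inP
    where
    inP⇒closed : InP Q → Closed Q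
    inP⇒closed (B , PB , B≡Q) y Qy z y~z =
      to (B≡Q z) (to ~⇔∈A y~z B PB (from (B≡Q y) Qy))

    -- A closed Q is its own P-closure, which lies in P by (P3).
    closed⇒inP : Closed Q → InP Q
    closed⇒inP Q-closed = inP-cong closure≡Q (⋂ᴾ-inP (λ C → ∀ y → Q y → y ∈ C))
      where
      ◇Q⇒Q : ∀ y → ¬ (∀ z → y ~ z → ¬ Q z) → Q y
      ◇Q⇒Q y ◇Q = dne λ ¬Qy → ◇Q λ z y~z Qz → ¬Qy (Q-closed z Qz y (~-sym y~z))
      closure≡Q : ∀ y → InPClosure Q y ⇔ Q y
      closure≡Q y = mk⇔ (λ y∈cl → ◇Q⇒Q y (to inPClosure⇔◇ y∈cl))
                        (λ Qy → from inPClosure⇔◇ λ □¬Q → □¬Q y ~-refl Qy)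

  closed⇔□ : ∀ {Q : X → Set a} →
             Closed Q ⇔ (∀ y → ¬ (Q y × ¬ (∀ z → y ~ z → Q z)))
  closed⇔□ = mk⇔ (λ Q-closed y (Qy , ¬□Q) → ¬□Q (Q-closed y Qy))
                 (λ h y Qy → dne λ ¬□Q → h y (Qy , ¬□Q))

  closed-cong : ∀ {Q Q′ : X → Set a} → (∀ y → Q y ⇔ Q′ y) →
                Closed Q ⇔ Closed Q′
  closed-cong Q≡Q′ =
    mk⇔ (λ c y Q′y z y~z → to (Q≡Q′ z) (c y (from (Q≡Q′ y) Q′y) z y~z))
        (λ c y Qy z y~z → from (Q≡Q′ z) (c y (to (Q≡Q′ y) Qy) z y~z))

  open import Relation.Binary.Reasoning.Setoid (⇔-setoid a)

  truth : ∀ x φ → _⊨_ M x φ ⇔ _⊨ᵏ_ (star M) x (t φ)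
  truth x (var p)  = mk⇔ (λ h → h) (λ h → h)
  truth x (¬ᶠ φ)   = mk⇔ (λ ⊭φ ⊨tφ → ⊭φ (from (truth x φ) ⊨tφ))
                         (λ ⊭tφ ⊨φ → ⊭tφ (to (truth x φ) ⊨φ))
  truth x (φ ∧ᶠ ψ) = mk⇔ (λ (⊨φ , ⊨ψ) → to (truth x φ) ⊨φ , to (truth x ψ) ⊨ψ)
                         (λ (⊨tφ , ⊨tψ) → from (truth x φ) ⊨tφ , from (truth x ψ) ⊨tψ)
  truth x (A φ)    = mk⇔ (λ h y → to (truth y φ) (h y))
                         (λ h y → from (truth y φ) (h y))
  truth x (E φ)    = begin
    InP (λ y → _⊨_ M y φ)                        ≈⟨ inP⇔closed ⟩
    Closed (λ y → _⊨_ M y φ)                     ≈⟨ closed-cong (λ y → truth y φ) ⟩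
    Closed (λ y → _⊨ᵏ_ (star M) y (t φ))          ≈⟨ closed⇔□ ⟩
    _⊨ᵏ_ (star M) x (t (E φ))                    ∎
  truth x (S φ)    = begin
    InPClosure (λ y → _⊨_ M y φ) x               ≈⟨ inPClosure⇔◇ ⟩
    ¬ (∀ y → x ~ y → ¬ _⊨_ M y φ)                 ≈⟨ ◇-cong (λ y → truth y φ) ⟩
    _⊨ᵏ_ (star M) x (t (S φ))                    ∎

theorem1 : {a : Level} → ExcludedMiddle a → (M : ExpertiseModel a) →
    IsEquivalence (RelModel.R (star M))
    × (∀ (x : ExpertiseModel.X M) (φ : Form) → (_⊨_ M x φ) ⇔ (_⊨ᵏ_ (star M) x (t φ)))
theorem1 em M = ~-isEquivalence , truth
  where open ExpertiseModelProperties em M
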